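{- For every $n\ge 2$: $\mathrm{pthin}_{ind}(nK_2)=2$ while $\mathrm{thin}_{cmp}(\overline{nK_2})=n$; and $\mathrm{pthin}_{cmp}(\overline{CR_n})=2$ while $\mathrm{thin}_{ind}(CR_n)=n$.
   Context: $nK_2$ is the graph consisting of $n$ disjoint edges; $\overline{H}$ denotes the complement of $H$; $CR_n$ is obtained from $K_{n,n}$ by removing a perfect matching. An ordering $<$ of $V(G)$ is consistent with a partition $\mathcal{V}$ if for every $p<q<r$ with $p,q$ in the same class and $pr\in E(G)$, also $qr\in E(G)$; strongly consistent if both $<$ and its reversal are consistent. $\mathrm{thin}_{ind}(G)$ (resp. $\mathrm{pthin}_{ind}(G)$) is the minimum $k$ such that $V(G)$ has a partition into $k$ independent sets with a consistent (resp. strongly consistent) ordering; $\mathrm{thin}_{cmp}(G)$ (resp. $\mathrm{pthin}_{cmp}(G)$) is defined likewise with cliques instead of independent sets. -}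

module Defs where

open import Data.Nat using (ℕ; _<_; _≤_)
open import Data.Fin using (Fin)
open import Data.Bool using (Bool; true; false)
open import Data.Product using (Σ; _×_; _,_; proj₁; proj₂; ∃-syntax)
open import Relation.Binary.PropositionalEquality using (_≡_; _≢_)
open import Relation.Nullary using (¬_)
open import Function.Definitions using (Injective)

record Graph (V : Set) : Set₁ where
  field
    Adj   : V → V → Set
    sym   : ∀ {u v} → Adj u v → Adj v u
    irrefl : ∀ {v} → ¬ Adj v v
open Graph public

compl : ∀ {V} → Graph V → Graph V
compl G = record
  { Adj = λ u v → u ≢ v × ¬ Adj G u v
  ; sym = λ { (u≢v , ¬a) → (λ e → u≢v (Relation.Binary.PropositionalEquality.sym e)) , (λ a → ¬a (Graph.sym G a)) }
  ; irrefl = λ { (v≢v , _) → v≢v Relation.Binary.PropositionalEquality.refl }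
  }

nK2 : (n : ℕ) → Graph (Fin n × Bool)
nK2 n = record
  { Adj = λ u v → proj₁ u ≡ proj₁ v × proj₂ u ≢ proj₂ v
  ; sym = λ { (e , d) → Relation.Binary.PropositionalEquality.sym e
                      , (λ x → d (Relation.Binary.PropositionalEquality.sym x)) }
  ; irrefl = λ { (_ , d) → d Relation.Binary.PropositionalEquality.refl }
  }

-- Crown graph CR_n = K_{n,n} minus a perfect matching:
-- vertices (i , b); (i,b) ~ (j,c) iff b ≠ c and i ≠ j.
CR : (n : ℕ) → Graph (Fin n × Bool)
CR n = record
  { Adj = λ u v → proj₂ u ≢ proj₂ v × proj₁ u ≢ proj₁ v
  ; sym = λ { (d , e) → (λ x → d (Relation.Binary.PropositionalEquality.sym x))
                      , (λ x → e (Relation.Binary.PropositionalEquality.sym x)) }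
  ; irrefl = λ { (d , _) → d Relation.Binary.PropositionalEquality.refl }
  }

record Ordering (V : Set) : Set where
  field
    rank : V → ℕ
    rank-inj : Injective _≡_ _≡_ rank
open Ordering public

_≺[_]_ : ∀ {V} → V → Ordering V → V → Set
p ≺[ O ] q = rank O p < rank O q

-- Reversed ordering (as a relation).
-- A partition of V into at most k classes: class assignment c : V → Fin k.
-- (Allowing empty classes does not change the minimum.)

ConsistentRel : ∀ {V k} → Graph V → (V → V → Set) → (V → Fin k) → Set
ConsistentRel G _<'_ c = ∀ p q r → p <' q → q <' r → c p ≡ c q → Adj G p r → Adj G q r

Consistent : ∀ {V k} → Graph V → Ordering V → (V → Fin k) → Set
Consistent G O c = ConsistentRel G (λ p q → p ≺[ O ] q) c

StronglyConsistent : ∀ {V k} → Graph V → Ordering V → (V → Fin k) → Set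
StronglyConsistent G O c =
  Consistent G O c × ConsistentRel G (λ p q → q ≺[ O ] p) c

IndepClasses : ∀ {V k} → Graph V → (V → Fin k) → Set
IndepClasses G c = ∀ u v → c u ≡ c v → ¬ Adj G u v

CliqueClasses : ∀ {V k} → Graph V → (V → Fin k) → Set
CliqueClasses G c = ∀ u v → c u ≡ c v → u ≢ v → Adj G u v

ThinInd : ∀ {V} → Graph V → ℕ → Set
ThinInd {V} G k = Σ (V → Fin k) λ c → IndepClasses G c × ∃[ O ] Consistent G O c

PThinInd : ∀ {V} → Graph V → ℕ → Set
PThinInd {V} G k = Σ (V → Fin k) λ c → IndepClasses G c × ∃[ O ] StronglyConsistent G O c

ThinCmp : ∀ {V} → Graph V → ℕ → Set
ThinCmp {V} G k = Σ (V → Fin k) λ c → CliqueClasses G c × ∃[ O ] Consistent G O c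

PThinCmp : ∀ {V} → Graph V → ℕ → Set
PThinCmp {V} G k = Σ (V → Fin k) λ c → CliqueClasses G c × ∃[ O ] StronglyConsistent G O c

IsMin : (ℕ → Set) → ℕ → Set
IsMin P k = P k × (∀ j → j < k → ¬ P j)

thin-ind≡ pthin-ind≡ thin-cmp≡ pthin-cmp≡ : ∀ {V} → Graph V → ℕ → Set
thin-ind≡ G = IsMin (ThinInd G)
pthin-ind≡ G = IsMin (PThinInd G)
thin-cmp≡ G = IsMin (ThinCmp G)
pthin-cmp≡ G = IsMin (PThinCmp G)

{-# OPTIONS --safe #-}
-- Vertex (i, b) is the end of the i-th pair {(i, false), (i, true)} on side b.
-- Classes by side are independent in nK₂ and cliques in the complement of CR_n; ordering by
-- index makes each pair contiguous, and since the only edges of nK₂ (resp. the only edges of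
-- the complement of CR_n across the sides) join the two ends of a pair, no vertex between
-- them can break consistency in either direction. An edge (resp. a non-edge) rules out one class.
-- For the value n, pigeonhole on the earlier end of each pair: two such ends in one class
-- would, by consistency, make the later one adjacent to its partner. The n-class partitions
-- meeting the bound come with orders built lexicographically from a block and the index.
module Submission where

open import Defs hiding (sym)
open import Data.Nat using (ℕ; zero; suc; _≤_; _+_; _*_; z≤n; s≤s)
open import Data.Nat.Properties
  using (≮⇒≥; <⇒≱; <-asym; <-cmp; ≤-refl; +-cancelˡ-<; module ≤-Reasoning)
open import Data.Fin using (Fin; zero; suc; toℕ; combine)
  renaming (_≤_ to _≤ᶠ_; _<_ to _<ᶠ_)
open import Data.Fin.Properties
  using (toℕ-injective; toℕ-combine; combine-injective; combine-monoˡ-<; pigeonhole; 2↔Bool)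
  renaming (<⇒≢ to <ᶠ⇒≢; ≤-antisym to ≤ᶠ-antisym)
open import Data.Bool using (Bool; true; false; not)
open import Data.Bool.Properties using (not-¬)
open import Data.Product using (Σ; ∃₂; _×_; _,_; proj₁; proj₂; uncurry)
open import Data.Empty using (⊥; ⊥-elim)
open import Function using (_∘_; flip)
open import Function.Bundles using (Inverse; Injection)
open import Function.Properties.Inverse using (Inverse⇒Injection; ↔-sym)
open import Relation.Nullary using (¬_; contradiction)
open import Relation.Binary.PropositionalEquality
  using (_≡_; _≢_; ≢-sym; refl; sym; trans; cong; cong₂; subst)
open import Relation.Binary.Definitions using (tri<; tri≈; tri>)

Vertex : ℕ → Set
Vertex n = Fin n × Bool

isMin : ∀ {P k} → P k → (∀ {j} → P j → k ≤ j) → IsMin P k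
isMin Pk least = Pk , λ j j<k Pj → <⇒≱ j<k (least Pj)

≺⇒≢ : ∀ {V} {O : Ordering V} {u v} → u ≺[ O ] v → u ≢ v
≺⇒≢ u≺v refl = <⇒≱ u≺v ≤-refl

distinct⇒2≤ : ∀ {k} {i j : Fin k} → i ≢ j → 2 ≤ k
distinct⇒2≤ {suc zero} {zero} {zero} i≢j = contradiction refl i≢j
distinct⇒2≤ {suc (suc k)} _ = s≤s (s≤s z≤n)

no-middle-in-Fin2 : ∀ {x y z : Fin 2} → x <ᶠ y → y <ᶠ z → ⊥
no-middle-in-Fin2 {y = suc zero} {z = suc zero} _ (s≤s ())

open Inverse 2↔Bool using () renaming (from to bit)

bit-injective : ∀ {b c} → bit b ≡ bit c → b ≡ c
bit-injective = Injection.injective (Inverse⇒Injection (↔-sym 2↔Bool))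

module Lexicographic {V : Set} {a b : ℕ} (block : V → Fin a) (pos : V → Fin b)
  (block-pos-injective : ∀ {u v} → block u ≡ block v → pos u ≡ pos v → u ≡ v) where

  lex : Ordering V
  lex = record
    { rank = λ v → toℕ (combine (block v) (pos v))
    ; rank-inj = λ e → uncurry block-pos-injective (combine-injective _ _ _ _ (toℕ-injective e))
    }

  ≺⇒block≤ : ∀ {u v} → u ≺[ lex ] v → block u ≤ᶠ block v
  ≺⇒block≤ {u} {v} u≺v = ≮⇒≥ λ v<u → <-asym u≺v (combine-monoˡ-< (pos v) (pos u) v<u)

  ≺⇒pos< : ∀ {u v} → block u ≡ block v → u ≺[ lex ] v → pos u <ᶠ pos v
  ≺⇒pos< {u} {v} same u≺v = +-cancelˡ-< (b * toℕ (block v)) _ _ (begin-strict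
    b * toℕ (block v) + toℕ (pos u)  ≡⟨ cong (λ x → b * toℕ x + toℕ (pos u)) (sym same) ⟩
    b * toℕ (block u) + toℕ (pos u)  ≡⟨ toℕ-combine (block u) (pos u) ⟨
    toℕ (combine (block u) (pos u))  <⟨ u≺v ⟩
    toℕ (combine (block v) (pos v))  ≡⟨ toℕ-combine (block v) (pos v) ⟩
    b * toℕ (block v) + toℕ (pos v)  ∎)
    where open ≤-Reasoning

  ≺-block≡ : ∀ {u v w} → u ≺[ lex ] v → v ≺[ lex ] w → block u ≡ block w → block v ≡ block w
  ≺-block≡ {v = v} u≺v v≺w same =
    ≤ᶠ-antisym (≺⇒block≤ v≺w) (subst (_≤ᶠ block v) same (≺⇒block≤ u≺v))

n≤#classes : ∀ {n k} (G : Graph (Vertex n)) (O : Ordering (Vertex n)) (c : Vertex n → Fin k) →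
  Consistent G O c →
  (∀ {i j b b′} → i ≢ j → c (i , b) ≡ c (j , b′) → Adj G (i , b) (j , not b′)) →
  (∀ {i b} → ¬ Adj G (i , b) (i , not b)) →
  n ≤ k
n≤#classes {n} G O c consistent cross partners-nonadjacent =
  ≮⇒≥ λ k<n → clash (pigeonhole k<n (c ∘ first))
  where
  earlier : (i : Fin n) → Σ Bool λ b → (i , b) ≺[ O ] (i , not b)
  earlier i with <-cmp (rank O (i , false)) (rank O (i , true))
  ... | tri< f≺t _ _ = false , f≺t
  ... | tri≈ _ f≡t _ = contradiction (rank-inj O f≡t) λ ()
  ... | tri> _ _ t≺f = true , t≺f

  first : Fin n → Vertex n
  first i = i , proj₁ (earlier i)

  ordered-clash : ∀ {i j} → i ≢ j → c (first i) ≡ c (first j) → first i ≺[ O ] first j → ⊥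
  ordered-clash {i} {j} i≢j same i≺j = partners-nonadjacent
    (consistent (first i) (first j) (j , not (proj₁ (earlier j)))
      i≺j (proj₂ (earlier j)) same (cross i≢j same))

  clash : (∃₂ λ i j → i <ᶠ j × c (first i) ≡ c (first j)) → ⊥
  clash (i , j , i<j , same) with <-cmp (rank O (first i)) (rank O (first j))
  ... | tri< i≺j _ _ = ordered-clash (<ᶠ⇒≢ i<j) same i≺j
  ... | tri≈ _ e _ = <ᶠ⇒≢ i<j (cong proj₁ (rank-inj O e))
  ... | tri> _ _ j≺i = ordered-clash (≢-sym (<ᶠ⇒≢ i<j)) (sym same) j≺i

IndexContiguous : ∀ {n} → (Vertex n → Vertex n → Set) → Set
IndexContiguous {n} _<′_ = ∀ (p q r : Vertex n) → proj₁ p ≡ proj₁ r → p <′ q → q <′ r → ⊥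

flip-contiguous : ∀ {n} {R : Vertex n → Vertex n → Set} →
  IndexContiguous R → IndexContiguous (flip R)
flip-contiguous contiguous p q r same p>q q>r = contiguous r q p (sym same) q>r p>q

bySide : ∀ {n} → Vertex n → Fin 2
bySide = bit ∘ proj₂

module IndexMajor {n : ℕ} =
  Lexicographic {Vertex n} proj₁ bySide
    (λ same-index same-bit → cong₂ _,_ same-index (bit-injective same-bit))

indexMajor : ∀ {n} → Ordering (Vertex n)
indexMajor = IndexMajor.lex

indexMajor-contiguous : ∀ {n} → IndexContiguous {n} _≺[ indexMajor ]_
indexMajor-contiguous {n} p q r same p≺q q≺r =
  no-middle-in-Fin2 (≺⇒pos< (trans same (sym q-block)) p≺q) (≺⇒pos< q-block q≺r)
  where
  open IndexMajor {n}
  q-block : proj₁ q ≡ proj₁ r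
  q-block = ≺-block≡ p≺q q≺r same

indexMajor-reversed-contiguous : ∀ {n} → IndexContiguous {n} (flip _≺[ indexMajor ]_)
indexMajor-reversed-contiguous = flip-contiguous {R = _≺[ indexMajor ]_} indexMajor-contiguous

nK2-consistent : ∀ {n k} {R : Vertex n → Vertex n → Set} (c : Vertex n → Fin k) →
  IndexContiguous R → ConsistentRel (nK2 n) R c
nK2-consistent c contiguous p q r p<q q<r _ (same-index , _) =
  ⊥-elim (contiguous p q r same-index p<q q<r)

complCR-consistent : ∀ {n} {R : Vertex n → Vertex n → Set} →
  IndexContiguous R → (∀ {u v} → R u v → u ≢ v) → ConsistentRel (compl (CR n)) R bySide
complCR-consistent contiguous R⇒≢ p q r p<q q<r same-class (_ , ¬cross) =
  R⇒≢ q<r , λ (q≢r-side , _) →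
    ¬cross ( (λ p≡r-side → q≢r-side (trans (sym (bit-injective same-class)) p≡r-side))
           , (λ same-index → contiguous p q r same-index p<q q<r))

pthin-ind-nK2 : ∀ n → pthin-ind≡ (nK2 (suc n)) 2
pthin-ind-nK2 n = isMin
  ( bySide
  , (λ _ _ same-class (_ , sides≢) → sides≢ (bit-injective same-class))
  , indexMajor
  , nK2-consistent bySide indexMajor-contiguous
  , nK2-consistent bySide indexMajor-reversed-contiguous)
  λ (_ , independent , _) → distinct⇒2≤ λ same-class →
    independent (zero , false) (zero , true) same-class (refl , λ ())

pthin-cmp-complCR : ∀ n → pthin-cmp≡ (compl (CR (suc (suc n)))) 2
pthin-cmp-complCR n = isMin
  ( bySide
  , (λ _ _ same-class u≢v → u≢v , λ (sides≢ , _) → sides≢ (bit-injective same-class))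
  , indexMajor
  , complCR-consistent indexMajor-contiguous (≺⇒≢ {O = indexMajor})
  , complCR-consistent indexMajor-reversed-contiguous (≢-sym ∘ ≺⇒≢ {O = indexMajor}))
  λ (_ , cliques , _) → distinct⇒2≤ λ same-class →
    proj₂ (cliques (zero , false) (suc zero , true) same-class (λ ())) ((λ ()) , (λ ()))

module SideMajor {n : ℕ} =
  Lexicographic {Vertex n} bySide proj₁
    (λ same-bit same-index → cong₂ _,_ same-index (bit-injective same-bit))

sideMajor : ∀ {n} → Ordering (Vertex n)
sideMajor = SideMajor.lex

¬true≺false : ∀ {n} {i j : Fin n} → ¬ (i , true) ≺[ sideMajor ] (j , false)
¬true≺false {n} {i} {j} t≺f with SideMajor.≺⇒block≤ {n} {i , true} {j , false} t≺f
... | ()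

another : ∀ {m} → Fin (suc (suc m)) → Fin (suc (suc m))
another zero = suc zero
another (suc _) = zero

another-≢ : ∀ {m} (i : Fin (suc (suc m))) → another i ≢ i
another-≢ zero ()
another-≢ (suc _) ()

crossClasses : ∀ {m} → Vertex (suc (suc m)) → Fin (suc (suc m))
crossClasses (i , false) = i
crossClasses (i , true) = another i

crossClasses-cliques : ∀ {m} → CliqueClasses (compl (nK2 (suc (suc m)))) crossClasses
crossClasses-cliques u v same u≢v = u≢v , not-partners u v same
  where
  not-partners : ∀ u v → crossClasses u ≡ crossClasses v → ¬ Adj (nK2 _) u v
  not-partners (_ , false) (_ , false) _ (_ , sides≢) = sides≢ refl
  not-partners (_ , true) (_ , true) _ (_ , sides≢) = sides≢ refl
  not-partners (i , false) (j , true) same (i≡j , _) = another-≢ j (trans (sym same) i≡j)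
  not-partners (i , true) (j , false) same (i≡j , _) = another-≢ i (trans same (sym i≡j))

crossClasses-consistent : ∀ {m} → Consistent (compl (nK2 (suc (suc m)))) sideMajor crossClasses
crossClasses-consistent p q r p≺q q≺r same _ =
  ≺⇒≢ {O = sideMajor} q≺r , not-partners p q r p≺q q≺r same
  where
  not-partners : ∀ p q r → p ≺[ sideMajor ] q → q ≺[ sideMajor ] r →
    crossClasses p ≡ crossClasses q → ¬ Adj (nK2 _) q r
  not-partners _ (_ , false) (_ , false) _ _ _ (_ , sides≢) = sides≢ refl
  not-partners _ (_ , true) (_ , true) _ _ _ (_ , sides≢) = sides≢ refl
  not-partners _ (_ , true) (_ , false) _ q≺r _ _ = ¬true≺false q≺r
  not-partners (_ , true) (_ , false) (_ , true) p≺q _ _ _ = ¬true≺false p≺q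
  not-partners (i , false) (_ , false) (_ , true) p≺q _ refl _ =
    ≺⇒≢ {O = sideMajor} {i , false} p≺q refl

thin-cmp-complNK2 : ∀ m → thin-cmp≡ (compl (nK2 (suc (suc m)))) (suc (suc m))
thin-cmp-complNK2 m = isMin
  (crossClasses , crossClasses-cliques , sideMajor , crossClasses-consistent {m})
  λ (c , _ , O , consistent) → n≤#classes (compl (nK2 _)) O c consistent
    (λ i≢j _ → (λ u≡v → i≢j (cong proj₁ u≡v)) , λ (i≡j , _) → i≢j i≡j)
    (λ (_ , ¬partners) → ¬partners (refl , not-¬ refl))

mergeFirstTwo : ∀ {m} → Fin (suc (suc m)) → Fin (suc (suc m))
mergeFirstTwo zero = suc zero
mergeFirstTwo (suc i) = suc i

mergeFirstTwo-collision : ∀ {m} {i j : Fin (suc (suc m))} →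
  mergeFirstTwo i ≡ mergeFirstTwo j → i <ᶠ j → j ≡ suc zero
mergeFirstTwo-collision {i = zero} {zero} _ ()
mergeFirstTwo-collision {i = zero} {suc zero} _ _ = refl
mergeFirstTwo-collision {i = zero} {suc (suc _)} () _
mergeFirstTwo-collision {i = suc _} {zero} _ ()
mergeFirstTwo-collision {i = suc _} {suc _} refl i<j = contradiction refl (<ᶠ⇒≢ i<j)

crownClasses : ∀ {m} → Vertex (suc (suc m)) → Fin (suc (suc m))
crownClasses (_ , false) = zero
crownClasses (i , true) = mergeFirstTwo i

crownClasses-side : ∀ {m} (u v : Vertex (suc (suc m))) →
  crownClasses u ≡ crownClasses v → proj₂ u ≡ proj₂ v
crownClasses-side (_ , false) (_ , false) _ = refl
crownClasses-side (_ , true) (_ , true) _ = refl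
crownClasses-side (_ , false) (zero , true) ()
crownClasses-side (_ , false) (suc _ , true) ()
crownClasses-side (zero , true) (_ , false) ()
crownClasses-side (suc _ , true) (_ , false) ()

-- Order: (1, false), then the true side, then the rest of the false side. Putting (1, false)
-- first is forced: it is adjacent to (0, true) but not to (1, true), which share a class.
crownBlock : ∀ {m} → Vertex (suc (suc m)) → Fin 3
crownBlock (_ , true) = suc zero
crownBlock (zero , false) = suc (suc zero)
crownBlock (suc zero , false) = zero
crownBlock (suc (suc _) , false) = suc (suc zero)

crownBlock-side : ∀ {m} (u v : Vertex (suc (suc m))) →
  crownBlock u ≡ crownBlock v → proj₂ u ≡ proj₂ v
crownBlock-side (_ , false) (_ , false) _ = refl
crownBlock-side (_ , true) (_ , true) _ = refl
crownBlock-side (zero , false) (_ , true) ()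
crownBlock-side (suc zero , false) (_ , true) ()
crownBlock-side (suc (suc _) , false) (_ , true) ()
crownBlock-side (_ , true) (zero , false) ()
crownBlock-side (_ , true) (suc zero , false) ()
crownBlock-side (_ , true) (suc (suc _) , false) ()

module CrownOrder {m : ℕ} =
  Lexicographic {Vertex (suc (suc m))} crownBlock proj₁
    (λ {u} {v} same-block same-index → cong₂ _,_ same-index (crownBlock-side u v same-block))

crownOrder : ∀ {m} → Ordering (Vertex (suc (suc m)))
crownOrder = CrownOrder.lex

crownBlock≤0 : ∀ {m} (u : Vertex (suc (suc m))) →
  toℕ (crownBlock u) ≤ 0 → u ≡ (suc zero , false)
crownBlock≤0 (_ , true) ()
crownBlock≤0 (zero , false) ()
crownBlock≤0 (suc zero , false) _ = refl
crownBlock≤0 (suc (suc _) , false) ()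

crownBlock≤1 : ∀ {m} (j : Fin (suc (suc m))) →
  toℕ (crownBlock (j , false)) ≤ 1 → j ≡ suc zero
crownBlock≤1 zero (s≤s ())
crownBlock≤1 (suc zero) _ = refl
crownBlock≤1 (suc (suc _)) (s≤s ())

nothing≺first : ∀ {m} {u : Vertex (suc (suc m))} {j} →
  u ≺[ crownOrder ] (j , false) → j ≢ suc zero
nothing≺first {m} {u} u≺ refl =
  ≺⇒≢ {O = crownOrder} u≺ (crownBlock≤0 u (CrownOrder.≺⇒block≤ {m} {u} {suc zero , false} u≺))

false≺true⇒first : ∀ {m} {j k : Fin (suc (suc m))} →
  (j , false) ≺[ crownOrder ] (k , true) → j ≡ suc zero
false≺true⇒first {m} {j} {k} f≺t =
  crownBlock≤1 j (CrownOrder.≺⇒block≤ {m} {j , false} {k , true} f≺t)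

crownClasses-consistent : ∀ {m} → Consistent (CR (suc (suc m))) crownOrder crownClasses
crownClasses-consistent {m} p q r p≺q q≺r same (p≢r-side , _) =
  q≢r-side , indices-differ p q r p≺q q≺r same q≢r-side
  where
  q≢r-side : proj₂ q ≢ proj₂ r
  q≢r-side q≡r-side = p≢r-side (trans (crownClasses-side p q same) q≡r-side)

  indices-differ : ∀ p q r → p ≺[ crownOrder ] q → q ≺[ crownOrder ] r →
    crownClasses p ≡ crownClasses q → proj₂ q ≢ proj₂ r → proj₁ q ≢ proj₁ r
  indices-differ _ (_ , false) (_ , false) _ _ _ sides≢ _ = sides≢ refl
  indices-differ _ (_ , true) (_ , true) _ _ _ sides≢ _ = sides≢ refl
  indices-differ p (j , false) (k , true) p≺q q≺r _ _ _ =
    nothing≺first {u = p} p≺q (false≺true⇒first {j = j} {k} q≺r)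
  indices-differ p@(_ , false) q@(_ , true) _ _ _ same _ _ =
    contradiction (crownClasses-side p q same) λ ()
  indices-differ p@(_ , true) q@(_ , true) (_ , false) p≺q q≺r same _ refl =
    nothing≺first {u = q} q≺r
      (mergeFirstTwo-collision same (CrownOrder.≺⇒pos< {m} {p} {q} refl p≺q))

thin-ind-CR : ∀ m → thin-ind≡ (CR (suc (suc m))) (suc (suc m))
thin-ind-CR m = isMin
  ( crownClasses
  , (λ u v same (sides≢ , _) → sides≢ (crownClasses-side u v same))
  , crownOrder
  , crownClasses-consistent {m})
  λ (c , independent , O , consistent) → n≤#classes (CR _) O c consistent
    (λ {i} {j} {b} {b′} i≢j same →
       (λ b≡¬b′ → independent (i , b) (j , b′) same
          ((λ b≡b′ → not-¬ refl (trans (sym b≡b′) b≡¬b′)) , i≢j))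
       , i≢j)
    (λ (_ , i≢i) → i≢i refl)

proposition28 : (n : ℕ) → 2 ≤ n →
    (pthin-ind≡ (nK2 n) 2 × thin-cmp≡ (compl (nK2 n)) n)
    × (pthin-cmp≡ (compl (CR n)) 2 × thin-ind≡ (CR n) n)
proposition28 (suc (suc m)) (s≤s (s≤s z≤n)) =
  (pthin-ind-nK2 (suc m) , thin-cmp-complNK2 m) , (pthin-cmp-complCR m , thin-ind-CR m)
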